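{- Let $\mathcal{A}_{\mathbf S}$ be a deformation of the braid arrangement in $\mathbb{R}^n$ and $T\in\mathcal{T}^{(m)}(n)$. The contribution $r_{\mathbf S}(X)$ of any maximal cadet sequence $X$ of $T$ equals the product of the contributions $r_{\mathbf S}(Y)$ over the $\mathbf S$-connected cadet sequences $Y$ of the (unique) partition of $X$ into $\mathbf S$-connected cadet sequences.
   Context: A deformation of the braid arrangement in $\mathbb{R}^n$ is a finite set $\mathcal{A}$ of hyperplanes $x_i-x_j=s$ ($1\le i<j\le n$, $s\in\mathbb{Z}$), encoded by $\mathbf S=(S_{i,j})_{i<j}$, $S_{i,j}=\{s:(x_i-x_j=s)\in\mathcal{A}\}$. For $i<j$: $S^-_{i,j}:=\{s\ge0:-s\in S_{i,j}\}$, $S^-_{j,i}:=\{0\}\cup\{s>0:s\in S_{i,j}\}$. $m=\max\{|s|:s\in\bigcup S_{i,j}\}$. $\mathcal{T}^{(m)}(n)$: rooted plane trees whose vertices are nodes (exactly $m+1$ ordered children) or leaves, with $n$ nodes labeled bijectively by $1,\dots,n$. $\mathsf{cadet}(u)$: rightmost child of node $u$ that is a node, if any. $\mathsf{lsib}(v)$: number of children of the parent of $v$ to the left of $v$. A cadet sequence is a sequence of nodes $(v_1,\dots,v_k)$ with $v_p=\mathsf{cadet}(v_{p-1})$; it is an $\mathbf S$-cadet sequence if $\sum_{p=i+1}^{j}\mathsf{lsib}(v_p)\notin S^-_{v_i,v_j}$ for all $i<j$. A cadet sequence $(v_1,\dots,v_k)$ is maximal if $v_k$ has no cadet and $v_1$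 is not the cadet of any node. An $\mathbf S$-cadet sequence $(v_i,\dots,v_j)$ inside the maximal cadet sequence $(v_1,\dots,v_k)$ is a maximal $\mathbf S$-cadet sequence if (a) $i=1$ or $(v_{i-1},\dots,v_j)$ is not $\mathbf S$-cadet, and (b) $j=k$ or $(v_i,\dots,v_{j+1})$ is not $\mathbf S$-cadet. Cadet sequences are identified with their node sets. A nonempty cadet sequence $X$ is $\mathbf S$-connected if (1) for every maximal $\mathbf S$-cadet sequence $Y$ of $T$, $X\cap Y=\emptyset$ or $Y\subseteq X$, and (2) no cadet sequence satisfying (1) is properly contained in $X$. An $\mathbf S$-boxing of a cadet sequence $X$ of length $k$ is a partition $B$ of its nodes into $\mathbf S$-cadet sequences, and $r_{\mathbf S}(X)=\sum_B(-1)^{k-|B|}$ over all $\mathbf S$-boxings $B$ of $X$. -}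

module Defs where

open import Data.Bool using (Bool; true; false; _∧_; _∨_; not; if_then_else_)
open import Data.Nat as ℕ using (ℕ; zero; suc; _+_; _∸_; _≤_; _<ᵇ_; _≡ᵇ_; _⊔_)
open import Data.Integer as ℤ using (ℤ; +_; -_; ∣_∣; _*_)
open import Data.Fin using (Fin; toℕ)
open import Data.List using (List; []; _∷_; [_]; _++_; _∷ʳ_; map; concatMap; foldr; allFin; upTo; length)
open import Data.Bool.ListAction using (all; any)
open import Data.List.Membership.Propositional using (_∈_)
open import Data.List.Relation.Binary.Subset.Propositional using (_⊆_)
open import Data.List.Relation.Binary.Disjoint.Propositional using (Disjoint)
open import Data.List.Relation.Binary.Permutation.Propositional using (_↭_)
open import Data.Product using (Σ; _×_; _,_)
open import Data.Sum using (_⊎_)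
open import Relation.Nullary using (¬_; does)
open import Relation.Binary.PropositionalEquality using (_≡_)

-- Deformations of the braid arrangement.
-- S i j : the (finite) list of integers s with (x_i - x_j = s) ∈ 𝒜,
-- only consulted for 1 ≤ i < j ≤ n.

Deformation : Set
Deformation = ℕ → ℕ → List ℤ

range1 : ℕ → List ℕ
range1 n = map suc (upTo n)

maxS : Deformation → ℕ → ℕ
maxS S n =
  foldr _⊔_ 0
    (concatMap (λ i → concatMap (λ j → if i <ᵇ j then map ∣_∣ (S i j) else [])
                                (range1 n))
               (range1 n))

memℤ : ℤ → List ℤ → Bool
memℤ x = any (λ y → does (x ℤ.≟ y))

-- membership s ∈ S⁻_{u,v} (s ≥ 0), for u ≠ v
--   u < v : S⁻_{u,v} = { s ≥ 0 : -s ∈ S_{u,v} }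
--   u > v : S⁻_{u,v} = {0} ∪ { s > 0 : s ∈ S_{v,u} }
inSminus : Deformation → ℕ → ℕ → ℕ → Bool
inSminus S u v s =
  if u <ᵇ v then memℤ (- (+ s)) (S u v)
  else (if v <ᵇ u then ((s ≡ᵇ 0) ∨ memℤ (+ s) (S v u)) else false)

-- Rooted plane trees: every node has exactly m+1 ordered children
-- (indexed left to right by Fin (suc m)); nodes carry a label.

data Tree (m : ℕ) : Set where
  leaf : Tree m
  node : ℕ → (Fin (suc m) → Tree m) → Tree m

labels : ∀ {m} → Tree m → List ℕ
labels leaf = []
labels {m} (node u c) = u ∷ concatMap (λ i → labels (c i)) (allFin (suc m))

LabelledBy : ∀ {m} → ℕ → Tree m → Set
LabelledBy n T = labels T ↭ range1 n

-- edges (u , p , w): node w is the child of node u at position p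
-- (p = number of children of u to the left of w)
edges : ∀ {m} → Tree m → List (ℕ × ℕ × ℕ)
edges leaf = []
edges {m} (node u c) = concatMap (λ i → here i (c i) ++ edges (c i)) (allFin (suc m))
  where
  here : Fin (suc m) → Tree m → List (ℕ × ℕ × ℕ)
  here i leaf = []
  here i (node w _) = (u , toℕ i , w) ∷ []

-- lsib(v) (root, which is never needed, gets 0)
lsibIn : ℕ → List (ℕ × ℕ × ℕ) → ℕ
lsibIn v [] = 0
lsibIn v ((_ , p , w) ∷ es) = if w ≡ᵇ v then p else lsibIn v es

lsib : ∀ {m} → Tree m → ℕ → ℕ
lsib T v = lsibIn v (edges T)

IsCadet : ∀ {m} → Tree m → ℕ → ℕ → Set
IsCadet T u v =
  Σ ℕ λ p → ((u , p , v) ∈ edges T) × (∀ q w → (u , q , w) ∈ edges T → q ≤ p)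

data CadetSeq {m} (T : Tree m) : List ℕ → Set where
  single : ∀ {v} → v ∈ labels T → CadetSeq T [ v ]
  step   : ∀ {v w vs} → IsCadet T v w → CadetSeq T (w ∷ vs) → CadetSeq T (v ∷ w ∷ vs)

MaxCadetSeq : ∀ {m} → Tree m → List ℕ → Set
MaxCadetSeq T X =
  CadetSeq T X
  × (∀ v rest → X ≡ v ∷ rest → ∀ u → ¬ IsCadet T u v)
  × (∀ init v → X ≡ init ∷ʳ v → ∀ w → ¬ IsCadet T v w)

-- S-cadet condition: for all i < j, Σ_{p=i+1}^{j} lsib(v_p) ∉ S⁻_{v_i,v_j}
okFrom : ∀ {m} → Tree m → Deformation → ℕ → ℕ → List ℕ → Bool
okFrom T S v acc [] = true
okFrom T S v acc (w ∷ ws) =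
  not (inSminus S v w (acc + lsib T w)) ∧ okFrom T S v (acc + lsib T w) ws

isSCadet : ∀ {m} → Tree m → Deformation → List ℕ → Bool
isSCadet T S [] = true
isSCadet T S (v ∷ ws) = okFrom T S v 0 ws ∧ isSCadet T S ws

SCadet : ∀ {m} → Tree m → Deformation → List ℕ → Set
SCadet T S Y = isSCadet T S Y ≡ true

MaxSCadetSeq : ∀ {m} → Tree m → Deformation → List ℕ → Set
MaxSCadetSeq T S Y =
  Σ (List ℕ) λ X → Σ (List ℕ) λ pre → Σ (List ℕ) λ post →
    MaxCadetSeq T X × X ≡ pre ++ Y ++ post × CadetSeq T Y × SCadet T S Y
    × (pre ≡ [] ⊎ Σ (List ℕ) λ pre′ → Σ ℕ λ u → pre ≡ pre′ ∷ʳ u × ¬ SCadet T S (u ∷ Y))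
    × (post ≡ [] ⊎ Σ ℕ λ w → Σ (List ℕ) λ post′ → post ≡ w ∷ post′ × ¬ SCadet T S (Y ∷ʳ w))

Cond1 : ∀ {m} → Tree m → Deformation → List ℕ → Set
Cond1 T S X = ∀ Y → MaxSCadetSeq T S Y → Disjoint X Y ⊎ Y ⊆ X

SConnected : ∀ {m} → Tree m → Deformation → List ℕ → Set
SConnected T S X =
  CadetSeq T X × Cond1 T S X
  × (∀ Z → CadetSeq T Z → Cond1 T S Z → ¬ (Z ⊆ X × ¬ (X ⊆ Z)))

data AllL {A : Set} (P : A → Set) : List A → Set where
  []  : AllL P []
  _∷_ : ∀ {x xs} → P x → AllL P xs → AllL P (x ∷ xs)

SConnPartition : ∀ {m} → Tree m → Deformation → List ℕ → List (List ℕ) → Set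
SConnPartition T S X Ps = AllL (SConnected T S) Ps × (Data.List.concat Ps ↭ X)

-- A partition of the nodes of a cadet sequence X into
-- cadet sequences is exactly a decomposition of X into consecutive
-- nonempty blocks (compositions); an S-boxing is one whose blocks are
-- all S-cadet.

compositions : {A : Set} → List A → List (List (List A))
compositions [] = [] ∷ []
compositions {A} (x ∷ xs) = concatMap ext (compositions xs)
  where
  ext : List (List A) → List (List (List A))
  ext [] = ([ x ] ∷ []) ∷ []
  ext (b ∷ bs) = ([ x ] ∷ b ∷ bs) ∷ ((x ∷ b) ∷ bs) ∷ []

sumℤ : List ℤ → ℤ
sumℤ = foldr ℤ._+_ (+ 0)

prodℤ : List ℤ → ℤ
prodℤ = foldr _*_ (+ 1)

r : ∀ {m} → Tree m → Deformation → List ℕ → ℤ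
r T S X =
  sumℤ (map (λ B → if all (isSCadet T S) B
                   then (- (+ 1)) ℤ.^ (length X ∸ length B)
                   else + 0)
            (compositions X))

{-# OPTIONS --safe #-}
-- Cut the maximal cadet sequence X into runs: the maximal segments in which every two
-- consecutive nodes form an S-cadet sequence. Being S-cadet passes to contiguous pieces, so
-- no S-cadet sequence contains two consecutive nodes of different runs, and a maximal
-- S-cadet sequence meeting a run lies inside it (it is a segment of X, because a node has at
-- most one parent and at most one cadet). Conversely, every S-cadet pair of consecutive
-- nodes extends to a maximal S-cadet sequence, so a sequence satisfying condition (1) that
-- meets a run contains all of it. Hence the runs are S-connected, and they form the only
-- partition of X into S-connected sequences.
--
-- For the same reason no box of an S-boxing straddles two runs, so r_S(X) is the product of
-- r_S over the runs. The induction goes through the signed sum over the boxings whose first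
-- box is prefixed by a fixed list p: looking at the first node x, either the box p x closes,
-- or x joins the first box of the rest, which is then prefixed by p x.
module Submission where

open import Defs
open import Data.Bool using (Bool; true; false; _∧_; if_then_else_)
open import Data.Bool.ListAction using (all)
open import Data.Bool.Properties using (∧-conicalˡ; ∧-conicalʳ; not-¬; ¬-not)
open import Data.Empty using (⊥; ⊥-elim)
open import Data.Fin using (Fin; toℕ)
open import Data.Fin.Properties using (toℕ-injective)
open import Data.Integer using (ℤ; +_; -_; _+_; _*_; _-_; _^_)
import Data.Integer.Properties as ℤ
open import Data.Integer.Solver using (module +-*-Solver)
open import Data.List using (List; []; _∷_; [_]; _++_; _∷ʳ_; map; concat; concatMap; allFin; length)
open import Data.List.Properties
  using (++-assoc; ++-identityʳ; ++-conicalʳ; ∷-injectiveˡ; ∷-injectiveʳ; length-++;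
         map-id; map-∘; map-cong; map-cong-local; map-concatMap)
open import Data.List.Membership.Propositional using (_∈_; _∉_; lose; find)
open import Data.List.Membership.Propositional.Properties
  using (∈-++⁺ˡ; ∈-++⁺ʳ; ∈-∃++; ∈-concat⁺′; ∈-concat⁻′; ∈-concatMap⁺; ∈-concatMap⁻; ∈-allFin)
open import Data.List.Relation.Binary.Subset.Propositional using (_⊆_)
open import Data.List.Relation.Binary.Permutation.Propositional
  using (_↭_; ↭-refl; ↭-prep; ↭-trans; ↭-sym; ↭-reflexive; ↭⇒↭ₛ)
import Data.List.Relation.Binary.Permutation.Propositional.Properties as ↭
import Data.List.Relation.Binary.Permutation.Setoid.Properties as ↭ₛ
open import Data.List.Relation.Unary.All as All using (All; []; _∷_)
import Data.List.Relation.Unary.All.Properties as All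
import Data.List.Relation.Unary.AllPairs as AllPairs
open import Data.List.Relation.Unary.Any using (Any; here; there; satisfied; any?)
open import Data.List.Relation.Unary.Linked as Linked using (Linked; []; [-]; _∷_)
open import Data.List.Relation.Unary.Unique.Propositional using (Unique; []; _∷_)
import Data.List.Relation.Unary.Unique.Propositional.Properties as Unique
open import Data.List.Reverse using (Reverse; []; _∶_∶ʳ_; reverseView)
open import Data.Nat using (ℕ; suc; _∸_; _≤_; _<_; z≤n; s≤s) renaming (_+_ to _+ℕ_)
import Data.Nat.Properties as ℕ
open import Data.List.Membership.DecPropositional ℕ._≟_ using (_∈?_)
open import Data.Product using (Σ; ∃; ∃₂; _×_; _,_; proj₁; proj₂)
open import Data.Sum using (_⊎_; inj₁; inj₂)
open import Function using (_∘_; id; case_of_)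
open import Relation.Nullary using (¬_; yes; no)
open import Relation.Binary.PropositionalEquality hiding ([_])

module _ {A : Set} where

  Infix : List A → List A → Set
  Infix Y X = ∃₂ λ a b → X ≡ a ++ Y ++ b

  Infix⇒⊆ : ∀ {Y X} → Infix Y X → Y ⊆ X
  Infix⇒⊆ (a , b , refl) v∈Y = ∈-++⁺ʳ a (∈-++⁺ˡ v∈Y)

  ∈⇒Infix-concat : ∀ {C Cs} → C ∈ Cs → Infix C (concat Cs)
  ∈⇒Infix-concat {Cs = C ∷ Cs} (here refl) = [] , concat Cs , refl
  ∈⇒Infix-concat {Cs = D ∷ Cs} (there C∈) with a , b , eq ← ∈⇒Infix-concat C∈ =
    D ++ a , b , trans (cong (D ++_) eq) (sym (++-assoc D a _))

  Adjacent : List A → A → A → Set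
  Adjacent X x y = ∃₂ λ a b → X ≡ a ++ x ∷ y ∷ b

  Linked-adjacent : ∀ {R : A → A → Set} {C X} a b → X ≡ a ++ C ++ b → Linked R C →
                    Linked (λ x y → R x y × Adjacent X x y) C
  Linked-adjacent a b eq []  = []
  Linked-adjacent a b eq [-] = [-]
  Linked-adjacent {C = x ∷ y ∷ C} a b eq (r ∷ l) =
    (r , a , C ++ b , eq) ∷ Linked-adjacent (a ∷ʳ x) b (trans eq (sym (++-assoc a [ x ] _))) l

  Linked-spread : ∀ {R : A → A → Set} {P : A → Set} →
                  (∀ {x y} → R x y → (P x → P y) × (P y → P x)) →
                  ∀ {C} → Linked R C → Any P C → All P C
  Linked-spread R⇒⇔ [-]     (here p)  = p ∷ []
  Linked-spread R⇒⇔ (r ∷ l) (here p)  = p ∷ Linked-spread R⇒⇔ l (here (proj₁ (R⇒⇔ r) p))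
  Linked-spread R⇒⇔ (r ∷ l) (there q) with Linked-spread R⇒⇔ l q
  ... | all@(py ∷ _) = proj₂ (R⇒⇔ r) py ∷ all

  data Seam (R : A → A → Set) : List A → List A → Set where
    seam : ∀ {C init z y t} → C ≡ init ∷ʳ z → R z y → Seam R C (y ∷ t)

  Unique-++⁻ˡ : ∀ (xs : List A) {ys} → Unique (xs ++ ys) → Unique xs
  Unique-++⁻ˡ []       _          = []
  Unique-++⁻ˡ (x ∷ xs) (x∉ ∷ xs!) = All.++⁻ˡ xs x∉ ∷ Unique-++⁻ˡ xs xs!

  Unique-++⁻ʳ : ∀ (xs : List A) {ys} → Unique (xs ++ ys) → Unique ys
  Unique-++⁻ʳ []       ys!       = ys!
  Unique-++⁻ʳ (x ∷ xs) (_ ∷ xs!) = Unique-++⁻ʳ xs xs!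

  Unique-++-disjoint : ∀ (xs : List A) {ys v} → Unique (xs ++ ys) → v ∈ xs → v ∉ ys
  Unique-++-disjoint (x ∷ xs) (x∉ ∷ _)  (here refl)  v∈ys = All.lookup x∉ (∈-++⁺ʳ xs v∈ys) refl
  Unique-++-disjoint (x ∷ xs) (_ ∷ xs!) (there v∈xs) v∈ys = Unique-++-disjoint xs xs! v∈xs v∈ys

  Unique-resp-↭ : ∀ {xs ys : List A} → xs ↭ ys → Unique xs → Unique ys
  Unique-resp-↭ xs↭ys = ↭ₛ.Unique-resp-↭ (setoid A) (↭⇒↭ₛ xs↭ys)

  ⊆-∷⁻ : ∀ {x} {xs ys : List A} → x ∉ xs → xs ⊆ x ∷ ys → xs ⊆ ys
  ⊆-∷⁻ x∉xs xs⊆ v∈xs with xs⊆ v∈xs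
  ... | here refl  = ⊥-elim (x∉xs v∈xs)
  ... | there v∈ys = v∈ys

  Unique-⊆⇒↭ : ∀ {xs ys : List A} → Unique xs → Unique ys → xs ⊆ ys → ys ⊆ xs → xs ↭ ys
  Unique-⊆⇒↭ {[]} {[]}    _ _ _ _ = ↭-refl
  Unique-⊆⇒↭ {[]} {_ ∷ _} _ _ _ ys⊆xs with () ← ys⊆xs (here refl)
  Unique-⊆⇒↭ {x ∷ xs} xs! ys! xs⊆ys ys⊆xs with ys₁ , ys₂ , refl ← ∈-∃++ (xs⊆ys (here refl)) =
    ↭-trans (↭-prep x (Unique-⊆⇒↭ (AllPairs.tail xs!) (AllPairs.tail x∷ys₁₂!)
                                   (⊆-∷⁻ (Unique.Unique[x∷xs]⇒x∉xs xs!) xs⊆)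
                                   (⊆-∷⁻ (Unique.Unique[x∷xs]⇒x∉xs x∷ys₁₂!) ys₁₂⊆)))
            (↭-sym (↭.shift x ys₁ ys₂))
    where
    x∷ys₁₂! : Unique (x ∷ ys₁ ++ ys₂)
    x∷ys₁₂! = Unique-resp-↭ (↭.shift x ys₁ ys₂) ys!
    xs⊆ : xs ⊆ x ∷ ys₁ ++ ys₂
    xs⊆ v∈xs = ↭.∈-resp-↭ (↭.shift x ys₁ ys₂) (xs⊆ys (there v∈xs))
    ys₁₂⊆ : ys₁ ++ ys₂ ⊆ x ∷ xs
    ys₁₂⊆ v∈ys = ys⊆xs (↭.∈-resp-↭ (↭-sym (↭.shift x ys₁ ys₂)) (there v∈ys))

  private
    Unique-prefix-≡ : ∀ {P C b b′ : List A} → Unique (P ++ b) → P ++ b ≡ C ++ b′ → P ⊆ C → C ⊆ P → P ≡ C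
    Unique-prefix-≡ {[]}    {[]}    _ _ _ _ = refl
    Unique-prefix-≡ {[]}    {_ ∷ _} _ _ _ C⊆P with () ← C⊆P (here refl)
    Unique-prefix-≡ {_ ∷ _} {[]}    _ _ P⊆C _ with () ← P⊆C (here refl)
    Unique-prefix-≡ {p ∷ P} {c ∷ C} (p∉ ∷ u) eq P⊆C C⊆P with refl ← ∷-injectiveˡ eq =
      cong (p ∷_) (Unique-prefix-≡ u (∷-injectiveʳ eq) (⊆-∷⁻ p∉P (P⊆C ∘ there)) (⊆-∷⁻ p∉C (C⊆P ∘ there)))
      where
      p∉P : p ∉ P
      p∉P p∈P = All.lookup p∉ (∈-++⁺ˡ p∈P) refl
      p∉C : p ∉ C
      p∉C p∈C = All.lookup p∉ (subst (p ∈_) (sym (∷-injectiveʳ eq)) (∈-++⁺ˡ p∈C)) refl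

    Unique-late-≡ : ∀ {P C b b′ : List A} {x} a → Unique (P ++ b) → P ++ b ≡ x ∷ a ++ C ++ b′ →
                    P ⊆ C → C ⊆ P → P ≡ C
    Unique-late-≡ {[]} {[]}    _ _ _ _ _ = refl
    Unique-late-≡ {[]} {_ ∷ _} _ _ _ _ C⊆P with () ← C⊆P (here refl)
    Unique-late-≡ {p ∷ P} a (p∉ ∷ _) eq P⊆C _ with refl ← ∷-injectiveˡ eq =
      ⊥-elim (All.lookup p∉ (subst (p ∈_) (sym (∷-injectiveʳ eq)) (∈-++⁺ʳ a (∈-++⁺ˡ (P⊆C (here refl))))) refl)

  Unique-infix-≡ : ∀ a a′ {P C b b′ : List A} → Unique (a ++ P ++ b) → a ++ P ++ b ≡ a′ ++ C ++ b′ →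
                   P ⊆ C → C ⊆ P → P ≡ C
  Unique-infix-≡ []      []       u eq P⊆C C⊆P = Unique-prefix-≡ u eq P⊆C C⊆P
  Unique-infix-≡ []      (_ ∷ a′) u eq P⊆C C⊆P = Unique-late-≡ a′ u eq P⊆C C⊆P
  Unique-infix-≡ (_ ∷ a) []       u eq P⊆C C⊆P = sym (Unique-late-≡ a (subst Unique eq u) (sym eq) C⊆P P⊆C)
  Unique-infix-≡ (_ ∷ a) (_ ∷ a′) (_ ∷ u) eq   = Unique-infix-≡ a a′ u (∷-injectiveʳ eq)

  Unique-concat⁻ : ∀ {Cs : List (List A)} → Unique (concat Cs) → All (_≢ []) Cs → Unique Cs
  Unique-concat⁻ {[]}           _ _              = []
  Unique-concat⁻ {[] ∷ _}       _ ([]≢[] ∷ _)    = ⊥-elim ([]≢[] refl)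
  Unique-concat⁻ {(h ∷ C) ∷ Cs} u (_ ∷ nonEmpty) =
    All.tabulate (λ { D∈Cs refl → Unique-++-disjoint (h ∷ C) u (here refl) (∈-concat⁺′ (here refl) D∈Cs) })
    ∷ Unique-concat⁻ (Unique-++⁻ʳ (h ∷ C) u) nonEmpty

module _ {A B : Set} (f : A → List B) where

  Unique-concatMap⁻ : ∀ {xs a} → Unique (concatMap f xs) → a ∈ xs → Unique (f a)
  Unique-concatMap⁻ {x ∷ xs} u (here refl) = Unique-++⁻ˡ (f x) u
  Unique-concatMap⁻ {x ∷ xs} u (there a∈)  = Unique-concatMap⁻ (Unique-++⁻ʳ (f x) u) a∈

  Unique-concatMap-block : ∀ {xs a b v} → Unique (concatMap f xs) → a ∈ xs → b ∈ xs →
                           v ∈ f a → v ∈ f b → a ≡ b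
  Unique-concatMap-block u (here refl) (here refl) _ _ = refl
  Unique-concatMap-block {x ∷ xs} u (here refl) (there b∈) v∈a v∈b =
    ⊥-elim (Unique-++-disjoint (f x) u v∈a (∈-concatMap⁺ f (lose b∈ v∈b)))
  Unique-concatMap-block {x ∷ xs} u (there a∈) (here refl) v∈a v∈b =
    ⊥-elim (Unique-++-disjoint (f x) u v∈b (∈-concatMap⁺ f (lose a∈ v∈a)))
  Unique-concatMap-block {x ∷ xs} u (there a∈) (there b∈) v∈a v∈b =
    Unique-concatMap-block (Unique-++⁻ʳ (f x) u) a∈ b∈ v∈a v∈b

Unique-concat-block : ∀ {A : Set} {Cs : List (List A)} {C D v} → Unique (concat Cs) →
                      C ∈ Cs → D ∈ Cs → v ∈ C → v ∈ D → C ≡ D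
Unique-concat-block {Cs = Cs} u = Unique-concatMap-block id (subst Unique (cong concat (sym (map-id Cs))) u)

module _ {A : Set} {P : A → Set} where

  AllL-lookup : ∀ {xs x} → AllL P xs → x ∈ xs → P x
  AllL-lookup (px ∷ _)  (here refl) = px
  AllL-lookup (_ ∷ pxs) (there x∈)  = AllL-lookup pxs x∈

  AllL-tabulate : ∀ {xs} → (∀ {x} → x ∈ xs → P x) → AllL P xs
  AllL-tabulate {[]}     _ = []
  AllL-tabulate {x ∷ xs} f = f (here refl) ∷ AllL-tabulate (f ∘ there)

-- Signed boxings

sumℤ-++ : ∀ xs ys → sumℤ (xs ++ ys) ≡ sumℤ xs + sumℤ ys
sumℤ-++ []       ys = sym (ℤ.+-identityˡ _)
sumℤ-++ (x ∷ xs) ys = trans (cong (_+_ x) (sumℤ-++ xs ys)) (sym (ℤ.+-assoc x _ _))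

sumℤ-concat : ∀ xss → sumℤ (concat xss) ≡ sumℤ (map sumℤ xss)
sumℤ-concat []         = refl
sumℤ-concat (xs ∷ xss) = trans (sumℤ-++ xs (concat xss)) (cong (_+_ (sumℤ xs)) (sumℤ-concat xss))

sumℤ-linear : ∀ {B : Set} {P : B → Set} (F G H : B → ℤ) c {L} → All P L →
              (∀ {x} → P x → F x ≡ c * G x - H x) →
              sumℤ (map F L) ≡ c * sumℤ (map G L) - sumℤ (map H L)
sumℤ-linear F G H c []                _  = cong (_- + 0) (sym (ℤ.*-zeroʳ c))
sumℤ-linear F G H c {x ∷ L} (px ∷ pL) F≡ =
  trans (cong₂ _+_ (F≡ px) (sumℤ-linear F G H c pL F≡))
        (solve 5 (λ c g h g′ h′ → (c :* g :- h) :+ (c :* g′ :- h′) := c :* (g :+ g′) :- (h :+ h′))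
               refl c (G x) (H x) _ _)
  where open +-*-Solver

prodℤ-↭ : ∀ {xs ys} → xs ↭ ys → prodℤ xs ≡ prodℤ ys
prodℤ-↭ xs↭ys = ↭ₛ.foldr-commMonoid (setoid ℤ) ℤ.*-1-isCommutativeMonoid (↭⇒↭ₛ xs↭ys)

sign : ℕ → ℤ
sign k = (- + 1) ^ k

sign-pred : ∀ {k n} → k < n → sign (n ∸ k) ≡ - sign (n ∸ suc k)
sign-pred {k} {suc n} (s≤s k≤n) rewrite ℕ.+-∸-assoc 1 k≤n = ℤ.-1*i≡-i (sign (n ∸ k))

indicator : Bool → ℤ
indicator true  = + 1
indicator false = + 0

module _ {A : Set} where

  extend : A → List (List A) → List (List (List A))
  extend x []       = ([ x ] ∷ []) ∷ []
  extend x (b ∷ bs) = ([ x ] ∷ b ∷ bs) ∷ ((x ∷ b) ∷ bs) ∷ []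

  compositions-∷ : ∀ x xs → compositions (x ∷ xs) ≡ concatMap (extend x) (compositions xs)
  compositions-∷ x xs = cong concat (map-cong (λ { [] → refl ; (_ ∷ _) → refl }) (compositions xs))

  compositions-length : ∀ xs → All (λ B → length B ≤ length xs) (compositions xs)
  compositions-length []       = z≤n ∷ []
  compositions-length (x ∷ xs) rewrite compositions-∷ x xs =
    All.concat⁺ (All.map⁺ (All.map extend-length (compositions-length xs)))
    where
    extend-length : ∀ {B} → length B ≤ length xs → All (λ B → length B ≤ suc (length xs)) (extend x B)
    extend-length {[]}    _  = s≤s z≤n ∷ []
    extend-length {_ ∷ _} B≤ = s≤s B≤ ∷ ℕ.m≤n⇒m≤1+n B≤ ∷ []

  data NonEmpty≤ (n : ℕ) : List (List A) → Set where
    nonEmpty≤ : ∀ {b bs} → length bs < n → NonEmpty≤ n (b ∷ bs)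

  compositions-nonEmpty≤ : ∀ x xs → All (NonEmpty≤ (suc (length xs))) (compositions (x ∷ xs))
  compositions-nonEmpty≤ x xs rewrite compositions-∷ x xs =
    All.concat⁺ (All.map⁺ (All.map extend-nonEmpty≤ (compositions-length xs)))
    where
    extend-nonEmpty≤ : ∀ {B} → length B ≤ length xs → All (NonEmpty≤ (suc (length xs))) (extend x B)
    extend-nonEmpty≤ {[]}    _  = nonEmpty≤ (s≤s z≤n) ∷ []
    extend-nonEmpty≤ {_ ∷ _} B≤ = nonEmpty≤ (s≤s B≤) ∷ nonEmpty≤ (s≤s (ℕ.m+n≤o⇒n≤o 1 B≤)) ∷ []

module SignedBoxings {A : Set} (ok : List A → Bool) where

  open ≡-Reasoning
  open +-*-Solver using (solve; _:=_; _:*_; _:-_; con)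

  boxingWeight : ℕ → List (List A) → ℤ
  boxingWeight n B = if all ok B then sign (n ∸ length B) else + 0

  boxingSum : List A → ℤ
  boxingSum X = sumℤ (map (boxingWeight (length X)) (compositions X))

  prefixedWeight : List A → ℕ → List (List A) → ℤ
  prefixedWeight p n []       = + 0
  prefixedWeight p n (b ∷ bs) = boxingWeight n ((p ++ b) ∷ bs)

  prefixedSum : List A → List A → ℤ
  prefixedSum p X = sumℤ (map (prefixedWeight p (length X)) (compositions X))

  boxingSum≡prefixedSum[] : ∀ {X} → X ≢ [] → boxingSum X ≡ prefixedSum [] X
  boxingSum≡prefixedSum[] {[]}     X≢[] = ⊥-elim (X≢[] refl)
  boxingSum≡prefixedSum[] {x ∷ xs} _    =
    cong sumℤ (map-cong-local (All.map (λ { (nonEmpty≤ _) → refl }) (compositions-nonEmpty≤ x xs)))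

  private
    if-∧ : ∀ a b (s : ℤ) → (if a ∧ b then s else + 0) ≡ indicator a * (if b then s else + 0)
    if-∧ true  b s = sym (ℤ.*-identityˡ _)
    if-∧ false b s = refl

    if-neg : ∀ c (s : ℤ) → (if c then - s else + 0) ≡ - (if c then s else + 0)
    if-neg true  s = refl
    if-neg false s = refl

  extend-prefixedWeight : ∀ p x {n B} → NonEmpty≤ n B →
    sumℤ (map (prefixedWeight p (suc n)) (extend x B))
      ≡ indicator (ok (p ∷ʳ x)) * boxingWeight n B - prefixedWeight (p ∷ʳ x) n B
  extend-prefixedWeight p x {n} (nonEmpty≤ {b} {bs} bs<n) = begin
    (if ok (p ∷ʳ x) ∧ β then s else + 0) + ((if γ then sign (n ∸ length bs) else + 0) + + 0)
      ≡⟨ cong₂ (λ u v → u + (v + + 0)) (if-∧ (ok (p ∷ʳ x)) β s)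
               (trans (cong (λ t → if γ then t else + 0) (sign-pred bs<n)) (if-neg γ s)) ⟩
    i * w + (- (if γ then s else + 0) + + 0)
      ≡⟨ cong (_+_ (i * w)) (ℤ.+-identityʳ _) ⟩
    i * w - (if ok (p ++ x ∷ b) ∧ all ok bs then s else + 0)
      ≡⟨ cong (λ q → i * w - (if ok q ∧ all ok bs then s else + 0)) (++-assoc p [ x ] b) ⟨
    i * w - (if ok ((p ∷ʳ x) ++ b) ∧ all ok bs then s else + 0) ∎
    where
    β = ok b ∧ all ok bs
    γ = ok (p ++ x ∷ b) ∧ all ok bs
    s = sign (n ∸ suc (length bs))
    i = indicator (ok (p ∷ʳ x))
    w = if β then s else + 0

  prefixedSum-∷ : ∀ p x xs →
    prefixedSum p (x ∷ xs) ≡ indicator (ok (p ∷ʳ x)) * boxingSum xs - prefixedSum (p ∷ʳ x) xs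
  prefixedSum-∷ p x [] with ok (p ++ [ x ])
  ... | true  = refl
  ... | false = refl
  prefixedSum-∷ p x (y ∷ ys) = begin
    sumℤ (map w (compositions (x ∷ y ∷ ys)))
      ≡⟨ cong (sumℤ ∘ map w) (compositions-∷ x (y ∷ ys)) ⟩
    sumℤ (map w (concatMap (extend x) (compositions (y ∷ ys))))
      ≡⟨ cong sumℤ (map-concatMap w (extend x) (compositions (y ∷ ys))) ⟩
    sumℤ (concat (map (map w ∘ extend x) (compositions (y ∷ ys))))
      ≡⟨ sumℤ-concat (map (map w ∘ extend x) (compositions (y ∷ ys))) ⟩
    sumℤ (map sumℤ (map (map w ∘ extend x) (compositions (y ∷ ys))))
      ≡⟨ cong sumℤ (map-∘ (compositions (y ∷ ys))) ⟨
    sumℤ (map (sumℤ ∘ map w ∘ extend x) (compositions (y ∷ ys)))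
      ≡⟨ sumℤ-linear _ (boxingWeight n) (prefixedWeight (p ∷ʳ x) n) (indicator (ok (p ∷ʳ x)))
                     (compositions-nonEmpty≤ y ys) (extend-prefixedWeight p x) ⟩
    indicator (ok (p ∷ʳ x)) * boxingSum (y ∷ ys) - prefixedSum (p ∷ʳ x) (y ∷ ys) ∎
    where
    n = length (y ∷ ys)
    w = prefixedWeight p (suc n)

  prefixedSum-dead : ∀ q x xs → (∀ b → ok (q ++ x ∷ b) ≡ false) → prefixedSum q (x ∷ xs) ≡ + 0
  prefixedSum-dead q x xs dead = begin
    prefixedSum q (x ∷ xs)
      ≡⟨ prefixedSum-∷ q x xs ⟩
    indicator (ok (q ∷ʳ x)) * boxingSum xs - prefixedSum (q ∷ʳ x) xs
      ≡⟨ cong₂ (λ b s → indicator b * boxingSum xs - s) (dead []) (dead-tail xs) ⟩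
    + 0 ∎
    where
    dead-tail : ∀ xs → prefixedSum (q ∷ʳ x) xs ≡ + 0
    dead-tail []        = refl
    dead-tail (x′ ∷ xs) = prefixedSum-dead (q ∷ʳ x) x′ xs
      (λ b → trans (cong ok (++-assoc q [ x ] (x′ ∷ b))) (dead (x′ ∷ b)))

  Cut : A → A → Set
  Cut z y = ∀ a b → ok (a ++ z ∷ y ∷ b) ≡ false

  private
    factor-out : ∀ i s t c → i * (s * c) - t * c ≡ (i * s - t) * c
    factor-out = solve 4 (λ i s t c → i :* (s :* c) :- t :* c := (i :* s :- t) :* c) refl

    ++-∷-≢-[] : ∀ (xs : List A) {z w} → xs ++ z ∷ w ≢ []
    ++-∷-≢-[] xs eq with () ← ++-conicalʳ xs _ eq

  mutual
    boxingSum-++ : ∀ {z y} → Cut z y → ∀ A B →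
                   boxingSum (A ++ z ∷ y ∷ B) ≡ boxingSum (A ∷ʳ z) * boxingSum (y ∷ B)
    boxingSum-++ {z} {y} cut A B = begin
      boxingSum (A ++ z ∷ y ∷ B)                   ≡⟨ boxingSum≡prefixedSum[] (++-∷-≢-[] A) ⟩
      prefixedSum [] (A ++ z ∷ y ∷ B)              ≡⟨ prefixedSum-++ cut [] A B ⟩
      prefixedSum [] (A ∷ʳ z) * boxingSum (y ∷ B)  ≡⟨ cong (_* boxingSum (y ∷ B))
                                                         (boxingSum≡prefixedSum[] (++-∷-≢-[] A)) ⟨
      boxingSum (A ∷ʳ z) * boxingSum (y ∷ B)       ∎

    prefixedSum-++ : ∀ {z y} → Cut z y → ∀ p A B →
                     prefixedSum p (A ++ z ∷ y ∷ B) ≡ prefixedSum p (A ∷ʳ z) * boxingSum (y ∷ B)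
    prefixedSum-++ {z} {y} cut p [] B = begin
      prefixedSum p (z ∷ y ∷ B)
        ≡⟨ prefixedSum-∷ p z (y ∷ B) ⟩
      i * c - prefixedSum (p ∷ʳ z) (y ∷ B)
        ≡⟨ cong (_-_ (i * c)) (prefixedSum-dead (p ∷ʳ z) y B
                                (λ b → trans (cong ok (++-assoc p [ z ] (y ∷ b))) (cut p b))) ⟩
      i * c - + 0
        ≡⟨ solve 2 (λ i c → i :* c :- con (+ 0) := (i :* con (+ 1) :- con (+ 0)) :* c) refl i c ⟩
      (i * + 1 - + 0) * c
        ≡⟨ cong (_* c) (prefixedSum-∷ p z []) ⟨
      prefixedSum p [ z ] * c ∎
      where
      i = indicator (ok (p ∷ʳ z))
      c = boxingSum (y ∷ B)
    prefixedSum-++ {z} {y} cut p (a ∷ A) B = begin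
      prefixedSum p (a ∷ A ++ z ∷ y ∷ B)
        ≡⟨ prefixedSum-∷ p a (A ++ z ∷ y ∷ B) ⟩
      i * boxingSum (A ++ z ∷ y ∷ B) - prefixedSum (p ∷ʳ a) (A ++ z ∷ y ∷ B)
        ≡⟨ cong₂ (λ s t → i * s - t) (boxingSum-++ cut A B) (prefixedSum-++ cut (p ∷ʳ a) A B) ⟩
      i * (boxingSum (A ∷ʳ z) * c) - prefixedSum (p ∷ʳ a) (A ∷ʳ z) * c
        ≡⟨ factor-out i _ _ c ⟩
      (i * boxingSum (A ∷ʳ z) - prefixedSum (p ∷ʳ a) (A ∷ʳ z)) * c
        ≡⟨ cong (_* c) (prefixedSum-∷ p a (A ∷ʳ z)) ⟨
      prefixedSum p (a ∷ A ∷ʳ z) * c ∎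
      where
      i = indicator (ok (p ∷ʳ a))
      c = boxingSum (y ∷ B)

  boxingSum-concat : ∀ {Cs} → Linked (Seam Cut) Cs → boxingSum (concat Cs) ≡ prodℤ (map boxingSum Cs)
  boxingSum-concat []           = refl
  boxingSum-concat {C ∷ []} [-] = trans (cong boxingSum (++-identityʳ C)) (sym (ℤ.*-identityʳ _))
  boxingSum-concat {_ ∷ (y ∷ t) ∷ Ds} (seam {init = init} {z} refl cut ∷ seams) = begin
    boxingSum ((init ∷ʳ z) ++ y ∷ t ++ concat Ds)
      ≡⟨ cong boxingSum (++-assoc init [ z ] _) ⟩
    boxingSum (init ++ z ∷ y ∷ t ++ concat Ds)
      ≡⟨ boxingSum-++ cut init (t ++ concat Ds) ⟩
    boxingSum (init ∷ʳ z) * boxingSum (concat ((y ∷ t) ∷ Ds))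
      ≡⟨ cong (boxingSum (init ∷ʳ z) *_) (boxingSum-concat seams) ⟩
    boxingSum (init ∷ʳ z) * prodℤ (map boxingSum ((y ∷ t) ∷ Ds)) ∎

-- Runs and maximal segments

module Runs {A : Set} (linked : A → A → Bool) where

  _~_ : A → A → Set
  x ~ y = linked x y ≡ true

  _≁_ : A → A → Set
  x ≁ y = linked x y ≡ false

  record RunDecomposition (X : List A) (Cs : List (List A)) : Set where
    field
      concat-≡      : concat Cs ≡ X
      nonEmpty      : All (_≢ []) Cs
      linked-within : All (Linked _~_) Cs
      seams         : Linked (Seam _≁_) Cs

  private
    runsFrom : ∀ x xs → ∃₂ λ t Cs → RunDecomposition (x ∷ xs) ((x ∷ t) ∷ Cs)
    runsFrom x [] = [] , [] , record
      { concat-≡ = refl ; nonEmpty = (λ ()) ∷ [] ; linked-within = [-] ∷ [] ; seams = [-] }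
    runsFrom x (y ∷ ys) with runsFrom y ys | linked x y in linked-xy
    ... | t , Cs , record { concat-≡ = eq ; nonEmpty = _ ∷ ne ; linked-within = l ∷ ls ; seams = s } | true =
      y ∷ t , Cs , record
        { concat-≡ = cong (x ∷_) eq ; nonEmpty = (λ ()) ∷ ne ; linked-within = (linked-xy ∷ l) ∷ ls
        ; seams = grow s }
      where
      grow : ∀ {D Ds} → Linked (Seam _≁_) ((y ∷ D) ∷ Ds) → Linked (Seam _≁_) ((x ∷ y ∷ D) ∷ Ds)
      grow [-]                              = [-]
      grow (seam {init = init} eq z≁y ∷ s) = seam {init = x ∷ init} (cong (x ∷_) eq) z≁y ∷ s
    ... | t , Cs , record { concat-≡ = eq ; nonEmpty = ne ; linked-within = ls ; seams = s } | false =
      [] , (y ∷ t) ∷ Cs , record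
        { concat-≡ = cong (x ∷_) eq ; nonEmpty = (λ ()) ∷ ne ; linked-within = [-] ∷ ls
        ; seams = seam {init = []} refl linked-xy ∷ s }

  runDecomposition : ∀ X → ∃ (RunDecomposition X)
  runDecomposition []       = [] , record { concat-≡ = refl ; nonEmpty = [] ; linked-within = [] ; seams = [] }
  runDecomposition (x ∷ xs) with t , Cs , d ← runsFrom x xs = (x ∷ t) ∷ Cs , d

  private
    linked-prefix : ∀ {Y b : List A} c {z y d} → Linked _~_ Y → z ≁ y → Y ++ b ≡ c ++ z ∷ y ∷ d →
                    ∃ λ b′ → c ∷ʳ z ≡ Y ++ b′
    linked-prefix {[]}          c  _ _ _ = c ∷ʳ _ , refl
    linked-prefix {_ ∷ []}      [] _ _ eq = [] , cong [_] (sym (∷-injectiveˡ eq))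
    linked-prefix {_ ∷ _ ∷ _}  [] (y₁~y₂ ∷ _) z≁y eq
      with refl ← ∷-injectiveˡ eq | refl ← ∷-injectiveˡ (∷-injectiveʳ eq)
      with () ← trans (sym y₁~y₂) z≁y
    linked-prefix {_ ∷ _} (c₀ ∷ c) l z≁y eq
      with b′ , eq′ ← linked-prefix c (Linked.tail l) z≁y (∷-injectiveʳ eq) =
      b′ , cong₂ _∷_ (∷-injectiveˡ (sym eq)) eq′

    no-straddle : ∀ a {Y b : List A} c {z y d} → Linked _~_ Y → z ≁ y → a ++ Y ++ b ≡ c ++ z ∷ y ∷ d →
               Infix Y (c ∷ʳ z) ⊎ ∃ λ a′ → y ∷ d ≡ a′ ++ Y ++ b
    no-straddle []      c        l z≁y eq = inj₁ ([] , linked-prefix c l z≁y eq)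
    no-straddle (_ ∷ a) []       l z≁y eq = inj₂ (a , sym (∷-injectiveʳ eq))
    no-straddle (_ ∷ a) (c₀ ∷ c) l z≁y eq with no-straddle a c l z≁y (∷-injectiveʳ eq)
    ... | inj₁ (a′ , b′ , eq′) = inj₁ (c₀ ∷ a′ , b′ , cong (c₀ ∷_) eq′)
    ... | inj₂ later           = inj₂ later

  linked-infix-within-run : ∀ {Cs} → Linked (Seam _≁_) Cs → ∀ a {y Y b} → concat Cs ≡ a ++ y ∷ Y ++ b →
                            Linked _~_ (y ∷ Y) → ∃ λ C → C ∈ Cs × Infix (y ∷ Y) C
  linked-infix-within-run [] [] ()
  linked-infix-within-run [] (_ ∷ _) ()
  linked-infix-within-run {C ∷ []} [-] a eq _ = C , here refl , a , _ , trans (sym (++-identityʳ C)) eq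
  linked-infix-within-run {_ ∷ (y′ ∷ t) ∷ Ds} (seam {init = init} {z} refl z≁y′ ∷ s) a eq l
    with no-straddle a init l z≁y′ (trans (sym eq) (++-assoc init [ z ] (y′ ∷ t ++ concat Ds)))
  ... | inj₁ Y⊑C        = _ , here refl , Y⊑C
  ... | inj₂ (a′ , eq′) with C , C∈ , Y⊑C ← linked-infix-within-run s a′ eq′ l = C , there C∈ , Y⊑C

module MaximalExtension {A : Set} (ok : List A → Bool)
                        (ok-prefix : ∀ xs ys → ok (xs ++ ys) ≡ true → ok xs ≡ true) where

  LeftMaximal : List A → List A → Set
  LeftMaximal pre Y = pre ≡ [] ⊎ ∃₂ λ pre′ u → pre ≡ pre′ ∷ʳ u × ¬ ok (u ∷ Y) ≡ true

  RightMaximal : List A → List A → Set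
  RightMaximal Y post = post ≡ [] ⊎ ∃₂ λ w post′ → post ≡ w ∷ post′ × ¬ ok (Y ∷ʳ w) ≡ true

  private
    extendLeft : ∀ {pre} → Reverse pre → ∀ mid → ok mid ≡ true →
                 ∃₂ λ pre₁ pre₂ → pre ≡ pre₁ ++ pre₂ × ok (pre₂ ++ mid) ≡ true × LeftMaximal pre₁ (pre₂ ++ mid)
    extendLeft [] mid ok-mid = [] , [] , refl , ok-mid , inj₁ refl
    extendLeft (pre ∶ rev ∶ʳ u) mid ok-mid with ok (u ∷ mid) in ok-u∷mid
    ... | false = pre ∷ʳ u , [] , sym (++-identityʳ _) , ok-mid , inj₂ (pre , u , refl , not-¬ ok-u∷mid)
    ... | true with pre₁ , pre₂ , refl , ok-Y , maximal ← extendLeft rev (u ∷ mid) ok-u∷mid =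
      pre₁ , pre₂ ∷ʳ u , ++-assoc pre₁ pre₂ [ u ] ,
      subst (λ Y → ok Y ≡ true) Y≡ ok-Y , subst (LeftMaximal pre₁) Y≡ maximal
      where
      Y≡ : pre₂ ++ u ∷ mid ≡ (pre₂ ∷ʳ u) ++ mid
      Y≡ = sym (++-assoc pre₂ [ u ] mid)

    extendRight : ∀ post mid → ok mid ≡ true →
                  ∃₂ λ post₁ post₂ → post ≡ post₁ ++ post₂ × ok (mid ++ post₁) ≡ true ×
                                     RightMaximal (mid ++ post₁) post₂
    extendRight [] mid ok-mid =
      [] , [] , refl , subst (λ Y → ok Y ≡ true) (sym (++-identityʳ mid)) ok-mid , inj₁ refl
    extendRight (w ∷ post) mid ok-mid with ok (mid ∷ʳ w) in ok-mid∷ʳw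
    ... | false = [] , w ∷ post , refl , subst (λ Y → ok Y ≡ true) (sym (++-identityʳ mid)) ok-mid ,
                  inj₂ (w , post , refl , subst (λ Y → ¬ ok (Y ∷ʳ w) ≡ true) (sym (++-identityʳ mid))
                                                 (not-¬ ok-mid∷ʳw))
    ... | true with post₁ , post₂ , refl , ok-Y , maximal ← extendRight post (mid ∷ʳ w) ok-mid∷ʳw =
      w ∷ post₁ , post₂ , refl ,
      subst (λ Y → ok Y ≡ true) Y≡ ok-Y , subst (λ Y → RightMaximal Y post₂) Y≡ maximal
      where
      Y≡ : (mid ∷ʳ w) ++ post₁ ≡ mid ++ w ∷ post₁
      Y≡ = ++-assoc mid [ w ] post₁

    LeftMaximal-++ : ∀ {pre Y} Z → LeftMaximal pre Y → LeftMaximal pre (Y ++ Z)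
    LeftMaximal-++ Z (inj₁ pre≡[])                 = inj₁ pre≡[]
    LeftMaximal-++ Z (inj₂ (pre′ , u , pre≡ , ¬ok)) = inj₂ (pre′ , u , pre≡ , ¬ok ∘ ok-prefix (u ∷ _) Z)

  record Extension (pre mid post : List A) : Set where
    field
      pre′ Y post′  : List A
      split         : pre ++ mid ++ post ≡ pre′ ++ Y ++ post′
      mid⊑Y         : Infix mid Y
      ok-Y          : ok Y ≡ true
      left-maximal  : LeftMaximal pre′ Y
      right-maximal : RightMaximal Y post′

  extend-maximally : ∀ pre mid post → ok mid ≡ true → Extension pre mid post
  extend-maximally pre mid post ok-mid
    with pre₁ , pre₂ , refl , ok-Y₁ , left ← extendLeft (reverseView pre) mid ok-mid
    with post₁ , post₂ , refl , ok-Y , right ← extendRight post (pre₂ ++ mid) ok-Y₁ = record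
      { pre′ = pre₁ ; Y = (pre₂ ++ mid) ++ post₁ ; post′ = post₂
      ; split = trans (++-assoc pre₁ pre₂ _) (cong (pre₁ ++_) (sym
                  (trans (++-assoc (pre₂ ++ mid) post₁ post₂) (++-assoc pre₂ mid (post₁ ++ post₂)))))
      ; mid⊑Y = pre₂ , post₁ , ++-assoc pre₂ mid post₁
      ; ok-Y = ok-Y
      ; left-maximal = LeftMaximal-++ post₁ left
      ; right-maximal = right }

-- Trees and cadet sequences

module _ {m : ℕ} where

  descendants : (Fin (suc m) → Tree m) → List ℕ
  descendants c = concatMap (λ i → labels (c i)) (allFin (suc m))

  ∈-descendants : ∀ c i {v} → v ∈ labels (c i) → v ∈ descendants c
  ∈-descendants c i v∈ = ∈-concatMap⁺ (λ j → labels (c j)) (lose (∈-allFin i) v∈)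

  module _ {r : ℕ} {c : Fin (suc m) → Tree m} (r∷c! : Unique (labels (node r c))) where

    root∉descendants : r ∉ descendants c
    root∉descendants = Unique.Unique[x∷xs]⇒x∉xs r∷c!

    Unique-subtree : ∀ i → Unique (labels (c i))
    Unique-subtree i = Unique-concatMap⁻ (λ j → labels (c j)) (AllPairs.tail r∷c!) (∈-allFin i)

    subtrees-disjoint : ∀ {i j v} → v ∈ labels (c i) → v ∈ labels (c j) → i ≡ j
    subtrees-disjoint = Unique-concatMap-block (λ j → labels (c j)) (AllPairs.tail r∷c!) (∈-allFin _) (∈-allFin _)

  data EdgeOf (u : ℕ) (c : Fin (suc m) → Tree m) : ℕ × ℕ × ℕ → Set where
    top  : ∀ i {p w c′} → toℕ i ≡ p → c i ≡ node w c′ → EdgeOf u c (u , p , w)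
    deep : ∀ i {e} → e ∈ edges (c i) → EdgeOf u c e

  edgeOf : ∀ u c {e} → e ∈ edges (node u c) → EdgeOf u c e
  edgeOf u c e∈ with i , e∈ᵢ ← satisfied (∈-concatMap⁻ _ {xs = allFin (suc m)} e∈)
                with c i in cᵢ≡ | e∈ᵢ
  ... | node w c′ | here refl = top i refl cᵢ≡
  ... | node w c′ | there e∈′ = deep i (subst (λ t → _ ∈ edges t) (sym cᵢ≡) e∈′)

  source∈labels : ∀ {t u p w} → (u , p , w) ∈ edges t → u ∈ labels t
  source∈labels {node r c} e∈ with edgeOf r c e∈
  ... | top _ _ _  = here refl
  ... | deep i e∈ᵢ = there (∈-descendants c i (source∈labels e∈ᵢ))

  target∈descendants : ∀ {r c u p w} → (u , p , w) ∈ edges (node r c) → w ∈ descendants c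
  target∈labels : ∀ {t u p w} → (u , p , w) ∈ edges t → w ∈ labels t

  target∈descendants {r} {c} e∈ with edgeOf r c e∈
  ... | top i _ cᵢ≡ = ∈-descendants c i (subst (λ t → _ ∈ labels t) (sym cᵢ≡) (here refl))
  ... | deep i e∈ᵢ  = ∈-descendants c i (target∈labels e∈ᵢ)

  target∈labels {node r c} e∈ = there (target∈descendants e∈)

  subtree-root-not-target : ∀ {r c i j w c′ u p} → Unique (labels (node r c)) →
                            c i ≡ node w c′ → (u , p , w) ∈ edges (c j) → ⊥
  subtree-root-not-target {c = c} {i} t! cᵢ≡ e∈ⱼ
    with refl ← subtrees-disjoint t! (subst (λ t → _ ∈ labels t) (sym cᵢ≡) (here refl)) (target∈labels e∈ⱼ) =
    root∉descendants (subst (λ t → Unique (labels t)) cᵢ≡ (Unique-subtree t! i))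
                     (target∈descendants (subst (λ t → _ ∈ edges t) cᵢ≡ e∈ⱼ))

  parent-unique : ∀ {t u u′ p p′ w} → Unique (labels t) →
                  (u , p , w) ∈ edges t → (u′ , p′ , w) ∈ edges t → u ≡ u′
  parent-unique {node r c} t! e∈ e′∈ with edgeOf r c e∈ | edgeOf r c e′∈
  ... | top _ _ _   | top _ _ _   = refl
  ... | top _ _ cᵢ≡ | deep _ e′∈ⱼ = ⊥-elim (subtree-root-not-target t! cᵢ≡ e′∈ⱼ)
  ... | deep _ e∈ᵢ  | top _ _ cⱼ≡ = ⊥-elim (subtree-root-not-target t! cⱼ≡ e∈ᵢ)
  ... | deep i e∈ᵢ  | deep j e′∈ⱼ
    with refl ← subtrees-disjoint t! (target∈labels e∈ᵢ) (target∈labels e′∈ⱼ) =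
    parent-unique (Unique-subtree t! i) e∈ᵢ e′∈ⱼ

  child-unique : ∀ {t u p w w′} → Unique (labels t) →
                 (u , p , w) ∈ edges t → (u , p , w′) ∈ edges t → w ≡ w′
  child-unique {node r c} t! e∈ e′∈ with edgeOf r c e∈ | edgeOf r c e′∈
  ... | top i iₚ cᵢ≡ | top j jₚ cⱼ≡
    with refl ← toℕ-injective (trans iₚ (sym jₚ)) with refl ← trans (sym cᵢ≡) cⱼ≡ = refl
  ... | top _ _ _   | deep j e′∈ⱼ = ⊥-elim (root∉descendants t! (∈-descendants c j (source∈labels e′∈ⱼ)))
  ... | deep i e∈ᵢ  | top _ _ _   = ⊥-elim (root∉descendants t! (∈-descendants c i (source∈labels e∈ᵢ)))
  ... | deep i e∈ᵢ  | deep j e′∈ⱼ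
    with refl ← subtrees-disjoint t! (source∈labels e∈ᵢ) (source∈labels e′∈ⱼ) =
    child-unique (Unique-subtree t! i) e∈ᵢ e′∈ⱼ

module Cadets {m : ℕ} (T : Tree m) (T! : Unique (labels T)) where

  cadet-injective : ∀ {u u′ w} → IsCadet T u w → IsCadet T u′ w → u ≡ u′
  cadet-injective (_ , e∈ , _) (_ , e′∈ , _) = parent-unique T! e∈ e′∈

  cadet-functional : ∀ {u v v′} → IsCadet T u v → IsCadet T u v′ → v ≡ v′
  cadet-functional (p , e∈ , p-max) (p′ , e′∈ , p′-max)
    with refl ← ℕ.≤-antisym (p′-max _ _ e∈) (p-max _ _ e′∈) = child-unique T! e∈ e′∈

  CadetSeq-suffix : ∀ a {x L} → CadetSeq T (a ++ x ∷ L) → CadetSeq T (x ∷ L)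
  CadetSeq-suffix []           cs          = cs
  CadetSeq-suffix (_ ∷ [])     (step _ cs) = cs
  CadetSeq-suffix (_ ∷ a₁ ∷ a) (step _ cs) = CadetSeq-suffix (a₁ ∷ a) cs

  CadetSeq-prefix : ∀ {x} I {b} → CadetSeq T (x ∷ I ++ b) → CadetSeq T (x ∷ I)
  CadetSeq-prefix []      (single x∈)           = single x∈
  CadetSeq-prefix []      (step (_ , e∈ , _) _) = single (source∈labels e∈)
  CadetSeq-prefix (_ ∷ I) (step c cs)           = step c (CadetSeq-prefix I cs)

  CadetSeq-infix : ∀ {Y X} → Infix Y X → Y ≢ [] → CadetSeq T X → CadetSeq T Y
  CadetSeq-infix {[]}    _              Y≢[] _  = ⊥-elim (Y≢[] refl)
  CadetSeq-infix {x ∷ I} (a , b , refl) _    cs = CadetSeq-prefix I (CadetSeq-suffix a cs)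

  CadetSeq-adjacent : ∀ a {u w L} → CadetSeq T (a ++ u ∷ w ∷ L) → IsCadet T u w
  CadetSeq-adjacent a cs with step c _ ← CadetSeq-suffix a cs = c

  CadetSeq-nonEmpty : ∀ {Y} → CadetSeq T Y → Y ≢ []
  CadetSeq-nonEmpty (single _) ()
  CadetSeq-nonEmpty (step _ _) ()

  FirstNotCadet : List ℕ → Set
  FirstNotCadet X = ∀ v rest → X ≡ v ∷ rest → ∀ u → ¬ IsCadet T u v

  LastHasNoCadet : List ℕ → Set
  LastHasNoCadet X = ∀ init v → X ≡ init ∷ʳ v → ∀ w → ¬ IsCadet T v w

  LastHasNoCadet-suffix : ∀ a {L} → LastHasNoCadet (a ++ L) → LastHasNoCadet L
  LastHasNoCadet-suffix a end init v eq = end (a ++ init) v (trans (cong (a ++_) eq) (sym (++-assoc a init [ v ])))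

  forward-determined : ∀ y Y X → CadetSeq T (y ∷ Y) → CadetSeq T (y ∷ X) → LastHasNoCadet (y ∷ X) →
                       ∃ λ b → X ≡ Y ++ b
  forward-determined y []       X        _           _             _   = X , refl
  forward-determined y (y′ ∷ Y) []       (step c _)  _             end = ⊥-elim (end [] y refl y′ c)
  forward-determined y (y′ ∷ Y) (x′ ∷ X) (step c cs) (step c′ cs′) end
    with refl ← cadet-functional c′ c
    with b , refl ← forward-determined y′ Y X cs cs′ (LastHasNoCadet-suffix [ y ] end) = b , refl

  backward-determined : ∀ {Ya} → Reverse Ya → ∀ Xa w Xb Yb →
                        CadetSeq T (Xa ++ w ∷ Xb) → CadetSeq T (Ya ++ w ∷ Yb) → FirstNotCadet (Xa ++ w ∷ Xb) →
                        ∃ λ a → Xa ≡ a ++ Ya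
  backward-determined [] Xa w Xb Yb _ _ _ = Xa , sym (++-identityʳ Xa)
  backward-determined (Ya ∶ rev ∶ʳ u) Xa w Xb Yb csX csY start with reverseView Xa
  ... | [] = ⊥-elim (start w Xb refl u (CadetSeq-adjacent Ya csY′))
    where
    csY′ : CadetSeq T (Ya ++ u ∷ w ∷ Yb)
    csY′ = subst (CadetSeq T) (++-assoc Ya [ u ] (w ∷ Yb)) csY
  ... | Xa ∶ _ ∶ʳ u′
    with refl ← cadet-injective (CadetSeq-adjacent Xa (subst (CadetSeq T) (++-assoc Xa [ u′ ] (w ∷ Xb)) csX))
                                (CadetSeq-adjacent Ya (subst (CadetSeq T) (++-assoc Ya [ u ] (w ∷ Yb)) csY))
    with a , refl ← backward-determined rev Xa u (w ∷ Xb) (w ∷ Yb)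
                      (subst (CadetSeq T) (++-assoc Xa [ u ] (w ∷ Xb)) csX)
                      (subst (CadetSeq T) (++-assoc Ya [ u ] (w ∷ Yb)) csY)
                      (subst FirstNotCadet (++-assoc Xa [ u ] (w ∷ Xb)) start) =
    a , ++-assoc a Ya [ u ]

  module Maximal {X : List ℕ} (maxX : MaxCadetSeq T X) where

    private
      csX : CadetSeq T X
      csX = proj₁ maxX

      start : FirstNotCadet X
      start = proj₁ (proj₂ maxX)

      end : LastHasNoCadet X
      end = proj₂ (proj₂ maxX)

      no-repeat : ∀ a w mid b → X ≢ a ++ w ∷ mid ++ w ∷ b
      no-repeat a w mid b refl
        with a′ , a≡ ← backward-determined (reverseView (a ++ w ∷ mid)) a w (mid ++ w ∷ b) b csX
                         (subst (CadetSeq T) (sym (++-assoc a (w ∷ mid) (w ∷ b))) csX) start =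
        ℕ.m+1+n≰m (length a) (begin
          length a +ℕ suc (length mid)       ≡⟨ length-++ a ⟨
          length (a ++ w ∷ mid)              ≤⟨ ℕ.m≤n+m _ (length a′) ⟩
          length a′ +ℕ length (a ++ w ∷ mid) ≡⟨ length-++ a′ ⟨
          length (a′ ++ a ++ w ∷ mid)        ≡⟨ cong length a≡ ⟨
          length a                           ∎)
        where open ℕ.≤-Reasoning

      Unique-suffix : ∀ a {xs} → X ≡ a ++ xs → Unique xs
      Unique-suffix a {[]}     _  = []
      Unique-suffix a {x ∷ xs} eq =
        All.tabulate (λ { v∈xs refl → repeat v∈xs })
        ∷ Unique-suffix (a ∷ʳ x) (trans eq (sym (++-assoc a [ x ] xs)))
        where
        repeat : x ∉ xs
        repeat x∈xs with mid , b , refl ← ∈-∃++ x∈xs = no-repeat a x mid b eq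

    Unique-maximal : Unique X
    Unique-maximal = Unique-suffix [] refl

    infix-of-maximal : ∀ {Y w} → CadetSeq T Y → w ∈ Y → w ∈ X → Infix Y X
    infix-of-maximal {Y} {w} csY w∈Y w∈X
      with Xa , Xb , refl ← ∈-∃++ w∈X | Ya , Yb , refl ← ∈-∃++ w∈Y
      with a , refl ← backward-determined (reverseView Ya) Xa w Xb Yb csX csY start
      with b , refl ← forward-determined w Yb Xb (CadetSeq-suffix Ya csY) (CadetSeq-suffix (a ++ Ya) csX)
                                         (LastHasNoCadet-suffix (a ++ Ya) end) =
      a , b , trans (++-assoc a Ya _) (cong (a ++_) (sym (++-assoc Ya (w ∷ Yb) b)))

-- S-connected cadet sequences

module _ {m : ℕ} (T : Tree m) (S : Deformation) where

  private
    okFrom-prefix : ∀ v acc xs ys → okFrom T S v acc (xs ++ ys) ≡ true → okFrom T S v acc xs ≡ true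
    okFrom-prefix v acc []       ys _  = refl
    okFrom-prefix v acc (w ∷ xs) ys ok =
      cong₂ _∧_ (∧-conicalˡ _ _ ok) (okFrom-prefix v _ xs ys (∧-conicalʳ _ _ ok))

  SCadet-prefix : ∀ xs ys → SCadet T S (xs ++ ys) → SCadet T S xs
  SCadet-prefix []       ys _  = refl
  SCadet-prefix (v ∷ xs) ys ok =
    cong₂ _∧_ (okFrom-prefix v 0 xs ys (∧-conicalˡ _ _ ok)) (SCadet-prefix xs ys (∧-conicalʳ _ _ ok))

  SCadet-suffix : ∀ xs ys → SCadet T S (xs ++ ys) → SCadet T S ys
  SCadet-suffix []       ys ok = ok
  SCadet-suffix (v ∷ xs) ys ok = SCadet-suffix xs ys (∧-conicalʳ _ _ ok)

  SCadet-linked : ∀ {Y} → SCadet T S Y → Linked (λ x y → SCadet T S (x ∷ y ∷ [])) Y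
  SCadet-linked {[]}        _  = []
  SCadet-linked {_ ∷ []}    _  = [-]
  SCadet-linked {x ∷ y ∷ Y} ok = SCadet-prefix (x ∷ y ∷ []) Y ok ∷ SCadet-linked (SCadet-suffix [ x ] (y ∷ Y) ok)

  SCadet-cut : ∀ {z y} → isSCadet T S (z ∷ y ∷ []) ≡ false → SignedBoxings.Cut (isSCadet T S) z y
  SCadet-cut {z} {y} z≁y a b =
    ¬-not λ ok → case trans (sym z≁y) (SCadet-prefix (z ∷ y ∷ []) b (SCadet-suffix a (z ∷ y ∷ b) ok)) of λ ()

module Connectedness {m : ℕ} (T : Tree m) (S : Deformation) (T! : Unique (labels T))
                     {X : List ℕ} (maxX : MaxCadetSeq T X) where

  open Cadets T T!
  open Maximal maxX
  open SignedBoxings (isSCadet T S)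
  open Runs (λ x y → isSCadet T S (x ∷ y ∷ []))
  open MaximalExtension (isSCadet T S) (SCadet-prefix T S)

  runs : List (List ℕ)
  runs = proj₁ (runDecomposition X)

  open RunDecomposition (proj₂ (runDecomposition X))

  private
    csX : CadetSeq T X
    csX = proj₁ maxX

  run-infix : ∀ {C} → C ∈ runs → Infix C X
  run-infix C∈ = subst (Infix _) concat-≡ (∈⇒Infix-concat C∈)

  run-CadetSeq : ∀ {C} → C ∈ runs → CadetSeq T C
  run-CadetSeq C∈ = CadetSeq-infix (run-infix C∈) (All.lookup nonEmpty C∈) csX

  Unique-concat-runs : Unique (concat runs)
  Unique-concat-runs = subst Unique (sym concat-≡) Unique-maximal

  runs-disjoint : ∀ {C D v} → C ∈ runs → D ∈ runs → v ∈ C → v ∈ D → C ≡ D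
  runs-disjoint = Unique-concat-block Unique-concat-runs

  linked-pair-in-MaxSCadetSeq : ∀ {x y} → Adjacent X x y → x ~ y → ∃ λ I → MaxSCadetSeq T S I × x ∈ I × y ∈ I
  linked-pair-in-MaxSCadetSeq {x} {y} (a , b , X≡) x~y =
    Y , (X , pre′ , post′ , maxX , X≡′ , csY , ok-Y , left-maximal , right-maximal) , x∈Y , y∈Y
    where
    open Extension (extend-maximally a (x ∷ y ∷ []) b x~y)
    X≡′ : X ≡ pre′ ++ Y ++ post′
    X≡′ = trans X≡ split
    x∈Y : x ∈ Y
    x∈Y = Infix⇒⊆ mid⊑Y (here refl)
    y∈Y : y ∈ Y
    y∈Y = Infix⇒⊆ mid⊑Y (there (here refl))
    csY : CadetSeq T Y
    csY = CadetSeq-infix (pre′ , post′ , X≡′) (λ Y≡[] → case subst (x ∈_) Y≡[] x∈Y of λ ()) csX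

  Cond1-absorbs-run : ∀ {Z C w} → Cond1 T S Z → C ∈ runs → w ∈ C → w ∈ Z → C ⊆ Z
  Cond1-absorbs-run {Z} cond1 C∈ w∈C w∈Z with a , b , X≡ ← run-infix C∈ =
    All.lookup (Linked-spread same-side (Linked-adjacent a b X≡ (All.lookup linked-within C∈)) (lose w∈C w∈Z))
    where
    same-side : ∀ {x y} → x ~ y × Adjacent X x y → (x ∈ Z → y ∈ Z) × (y ∈ Z → x ∈ Z)
    same-side (x~y , adj) with I , maxI , x∈I , y∈I ← linked-pair-in-MaxSCadetSeq adj x~y with cond1 I maxI
    ... | inj₁ Z#I = (λ x∈Z → ⊥-elim (Z#I (x∈Z , x∈I))) , (λ y∈Z → ⊥-elim (Z#I (y∈Z , y∈I)))
    ... | inj₂ I⊆Z = (λ _ → I⊆Z y∈I) , (λ _ → I⊆Z x∈I)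

  run-Cond1 : ∀ {C} → C ∈ runs → Cond1 T S C
  run-Cond1 C∈ [] (_ , _ , _ , _ , _ , csY , _) = ⊥-elim (CadetSeq-nonEmpty csY refl)
  run-Cond1 {C} C∈ (y ∷ Y) (_ , _ , _ , _ , _ , csY , ok-Y , _) with any? (_∈? C) (y ∷ Y)
  ... | no ¬shared = inj₁ λ (v∈C , v∈Y) → ¬shared (lose v∈Y v∈C)
  ... | yes shared
    with w , w∈Y , w∈C ← find shared
    with a , b , X≡ ← infix-of-maximal csY w∈Y (Infix⇒⊆ (run-infix C∈) w∈C)
    with D , D∈ , Y⊑D ← linked-infix-within-run seams a (trans concat-≡ X≡) (SCadet-linked T S ok-Y)
    with refl ← runs-disjoint D∈ C∈ (Infix⇒⊆ Y⊑D w∈Y) w∈C = inj₂ (Infix⇒⊆ Y⊑D)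

  run-SConnected : ∀ {C} → C ∈ runs → SConnected T S C
  run-SConnected {C} C∈ = run-CadetSeq C∈ , run-Cond1 C∈ , minimal
    where
    minimal : ∀ Z → CadetSeq T Z → Cond1 T S Z → ¬ (Z ⊆ C × ¬ (C ⊆ Z))
    minimal []      csZ _     _           = CadetSeq-nonEmpty csZ refl
    minimal (z ∷ Z) _   cond1 (Z⊆C , C⊈Z) = C⊈Z (Cond1-absorbs-run cond1 C∈ (Z⊆C (here refl)) (here refl))

  runs-partition : SConnPartition T S X runs
  runs-partition = AllL-tabulate run-SConnected , ↭-reflexive concat-≡

  r-runs : r T S X ≡ prodℤ (map (r T S) runs)
  r-runs = trans (cong (r T S) (sym concat-≡)) (boxingSum-concat (Linked.map cut seams))
    where
    cut : ∀ {C D} → Seam _≁_ C D → Seam Cut C D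
    cut (seam C≡ z≁y) = seam C≡ (SCadet-cut T S z≁y)

  module _ {Ps : List (List ℕ)} (partition : SConnPartition T S X Ps) where

    private
      sconnected : AllL (SConnected T S) Ps
      sconnected = proj₁ partition

      ∈-X : ∀ {P v} → P ∈ Ps → v ∈ P → v ∈ X
      ∈-X P∈ v∈P = ↭.∈-resp-↭ (proj₂ partition) (∈-concat⁺′ v∈P P∈)

    block-is-run : ∀ {P} → P ∈ Ps → P ∈ runs
    block-is-run {[]} P∈ = ⊥-elim (CadetSeq-nonEmpty (proj₁ (AllL-lookup sconnected P∈)) refl)
    block-is-run {p ∷ P} P∈
      with csP , cond1 , minimal ← AllL-lookup sconnected P∈
      with C , p∈C , C∈ ← ∈-concat⁻′ runs (subst (p ∈_) (sym concat-≡) (∈-X P∈ (here refl)))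
      with a , b , X≡a++P++b ← infix-of-maximal csP (here refl) (∈-X P∈ (here refl))
      with a′ , b′ , X≡a′++C++b′ ← run-infix C∈ =
      subst (_∈ runs) (sym P≡C) C∈
      where
      C⊆P : C ⊆ p ∷ P
      C⊆P = Cond1-absorbs-run cond1 C∈ p∈C (here refl)
      P⊆C : p ∷ P ⊆ C
      P⊆C {v} v∈P with v ∈? C
      ... | yes v∈C = v∈C
      ... | no  v∉C = ⊥-elim (minimal C (run-CadetSeq C∈) (run-Cond1 C∈) (C⊆P , λ P⊆C′ → v∉C (P⊆C′ v∈P)))
      P≡C : p ∷ P ≡ C
      P≡C = Unique-infix-≡ a a′ (subst Unique X≡a++P++b Unique-maximal)
                           (trans (sym X≡a++P++b) X≡a′++C++b′) P⊆C C⊆P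

    run-is-block : ∀ {C} → C ∈ runs → C ∈ Ps
    run-is-block {[]} C∈ = ⊥-elim (All.lookup nonEmpty C∈ refl)
    run-is-block {h ∷ C} C∈
      with P , h∈P , P∈ ← ∈-concat⁻′ Ps (↭.∈-resp-↭ (↭-sym (proj₂ partition)) (Infix⇒⊆ (run-infix C∈) (here refl)))
      with refl ← runs-disjoint (block-is-run P∈) C∈ h∈P (here refl) = P∈

    partition-↭-runs : Ps ↭ runs
    partition-↭-runs = Unique-⊆⇒↭ Unique-Ps (Unique-concat⁻ Unique-concat-runs nonEmpty) block-is-run run-is-block
      where
      Unique-Ps : Unique Ps
      Unique-Ps = Unique-concat⁻ (Unique-resp-↭ (↭-sym (proj₂ partition)) Unique-maximal)
                                 (All.tabulate (λ P∈ → CadetSeq-nonEmpty (proj₁ (AllL-lookup sconnected P∈))))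

Unique-labels : ∀ {n m} {T : Tree m} → LabelledBy n T → Unique (labels T)
Unique-labels {n} labelled = Unique-resp-↭ (↭-sym labelled) (Unique.map⁺ ℕ.suc-injective (Unique.upTo⁺ n))

lemma3p11 : (n m : ℕ) (S : Deformation) → m ≡ maxS S n →
    (T : Tree m) → LabelledBy n T →
    (X : List ℕ) → MaxCadetSeq T X →
    Σ (List (List ℕ)) (SConnPartition T S X)
    × (∀ Ps → SConnPartition T S X Ps → r T S X ≡ prodℤ (map (r T S) Ps))
lemma3p11 n m S _ T labelled X maxX =
  (runs , runs-partition) ,
  λ Ps partition → trans r-runs (sym (prodℤ-↭ (↭.map⁺ (r T S) (partition-↭-runs partition))))
  where open Connectedness T S (Unique-labels labelled) maxX
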